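{- If a graph class $\mathcal{F}$ has a $(\sigma,\tau)$-sparse cover scheme, then $\mathcal{F}$ has a distance-invariant, disjunctive $\sigma$-ADT labelling scheme with labels of size $O(\tau)$ (each label consists of at most $\tau$ equality codes and no prefix).
   Context: The weak diameter of $S\subseteq V(G)$ is $\max_{x,y\in S}\mathsf{dist}_G(x,y)$. $B(u,r)$ is the set of vertices at distance at most $r$ from $u$. A $(\sigma,\tau,\Delta)$-sparse cover of $G$ is a family $\mathcal{C}$ of subsets of $V(G)$, each of weak diameter at most $\Delta$, such that (i) for each $u$ some $C\in\mathcal{C}$ contains $B(u,\Delta/\sigma)$, and (ii) each vertex lies in at most $\tau$ sets of $\mathcal{C}$. $G$ admits a $(\sigma,\tau)$-sparse cover scheme if it has a $(\sigma,\tau,\Delta)$-sparse cover for every $\Delta$; $\mathcal{F}$ has such a scheme if every graph in it does. A distance-invariant disjunctive $\sigma$-ADT labelling scheme: there is a single decoder such that for every $r>0$ and every $G\in\mathcal{F}$ there is a deterministic labelling assigning to each vertex $x$ a vector $\vec q(x)$ of natural numbers (equality codes); the decoder outputs $1$ iff some entry of $\vec q(x)$ equals some entry of $\vec q(y)$ (a disjunction of equality tests); it must output $1$ whenever $\mathsf{dist}_G(x,y)\le r$ and $0$ whenever $\mathsf{dist}_G(x,y)>\sigma r$.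
   Formalization: The parameters σ and r range over the positive rationals. -}

module Defs where

open import Data.Nat using (ℕ; zero; suc)
open import Data.Integer using (+_)
open import Data.Rational using (ℚ; _/_; _*_; _≤_; _<_; 0ℚ)
open import Data.Bool using (Bool; true; false)
open import Data.Fin using (Fin)
open import Data.Fin.Subset using (Subset; _∈_; inside; outside)
open import Data.Vec using (lookup)
open import Data.List using (List; length; []; _∷_)
open import Data.List.Membership.Propositional renaming (_∈_ to _∈ₗ_)
open import Data.Product using (Σ; ∃; _×_; Σ-syntax; ∃-syntax)
open import Relation.Binary.PropositionalEquality using (_≡_)
open import Relation.Nullary using (¬_)
import Data.Nat as ℕ

record Graph : Set where
  field
    n        : ℕ
    adj      : Fin n → Fin n → Bool
    adj-sym  : ∀ x y → adj x y ≡ adj y x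
    adj-irr  : ∀ x → adj x x ≡ false

open Graph public

V : Graph → Set
V G = Fin (n G)

data Walk (G : Graph) : V G → V G → ℕ → Set where
  stay : ∀ x → Walk G x x 0
  step : ∀ {x y z k} → adj G x y ≡ true → Walk G y z k → Walk G x z (ℕ.suc k)

ℕ→ℚ : ℕ → ℚ
ℕ→ℚ k = + k / 1

-- dist_G(x,y) ≤ t  (t rational): some walk of length k with k ≤ t.
-- (Shortest-path distance is the least such k; dist = ∞ if no walk.)
DistLe : (G : Graph) → V G → V G → ℚ → Set
DistLe G x y t = ∃[ k ] (Walk G x y k × ℕ→ℚ k ≤ t)

GraphClass : Set₁
GraphClass = Graph → Set

WeakDiamLe : (G : Graph) → Subset (n G) → ℚ → Set
WeakDiamLe G S Δ = ∀ x y → x ∈ S → y ∈ S → DistLe G x y Δ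

-- B(u, ρ) ⊆ C, where ρ = Δ/σ is encoded as: dist(u,v) ≤ Δ/σ  ⇔  σ·dist(u,v) ≤ Δ
BallSubset : (G : Graph) → (σ Δ : ℚ) → V G → Subset (n G) → Set
BallSubset G σ Δ u C = ∀ v → (∃[ k ] (Walk G u v k × σ * ℕ→ℚ k ≤ Δ)) → v ∈ C

count : ∀ {m} → List (Subset m) → Fin m → ℕ
count [] x = 0
count (C ∷ 𝒞) x with lookup C x
... | inside  = ℕ.suc (count 𝒞 x)
... | outside = count 𝒞 x

SparseCover : (G : Graph) → (σ : ℚ) → (τ : ℕ) → (Δ : ℚ) → List (Subset (n G)) → Set
SparseCover G σ τ Δ 𝒞 =
    (∀ C → C ∈ₗ 𝒞 → WeakDiamLe G C Δ)
  × (∀ u → ∃[ C ] (C ∈ₗ 𝒞 × BallSubset G σ Δ u C))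
  × (∀ x → count 𝒞 x ℕ.≤ τ)

HasSparseCoverScheme : (G : Graph) → ℚ → ℕ → Set
HasSparseCoverScheme G σ τ = ∀ Δ → 0ℚ < Δ → ∃[ 𝒞 ] SparseCover G σ τ Δ 𝒞

ClassHasSparseCoverScheme : GraphClass → ℚ → ℕ → Set
ClassHasSparseCoverScheme 𝓕 σ τ = ∀ G → 𝓕 G → HasSparseCoverScheme G σ τ

-- The fixed disjunctive decoder: outputs 1 iff some entry of qx equals some entry of qy.
SharesEntry : List ℕ → List ℕ → Set
SharesEntry qx qy = ∃[ a ] (a ∈ₗ qx × a ∈ₗ qy)

HasDisjunctiveADTScheme : GraphClass → (σ : ℚ) → (L : ℕ) → Set
HasDisjunctiveADTScheme 𝓕 σ L =
  ∀ (r : ℚ) → 0ℚ < r → ∀ G → 𝓕 G →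
    Σ[ q ∈ (V G → List ℕ) ]
        (∀ x → length (q x) ℕ.≤ L)
      × (∀ x y → DistLe G x y r → SharesEntry (q x) (q y))
      × (∀ x y → ¬ DistLe G x y (σ * r) → ¬ SharesEntry (q x) (q y))

{-# OPTIONS --safe #-}
module Submission where

open import Defs
open import Data.Nat using (ℕ)
open import Data.Rational using (ℚ; Positive)

import Data.Nat as ℕ
import Data.Rational as ℚ
import Data.Rational.Properties as ℚ
open import Data.Fin using (Fin; toℕ)
open import Data.Fin.Subset using (Subset; _∈_; ⊥; inside; outside)
open import Data.Fin.Subset.Properties using (∉⊥)
open import Data.Vec using (lookup)
open import Data.Vec.Properties using ([]=⇒lookup; lookup⇒[]=)
open import Data.List using (List; []; _∷_; length; map)
open import Data.List.Properties using (length-map)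
open import Data.List.Relation.Unary.Any using (here; there; index)
import Data.List.Membership.Propositional as List
open import Data.List.Membership.Propositional.Properties using (∈-map⁺; ∈-map⁻)
open import Data.Product using (_×_; _,_; ∃-syntax)
open import Data.Empty using (⊥-elim)
open import Relation.Nullary using (¬_)
open import Relation.Binary.PropositionalEquality using (_≡_; refl; cong; trans)

-- A vertex is labelled by the positions of the clusters containing it. Taking
-- Δ = σ r, a cluster containing B(x, r) carries a position shared by x and every
-- y within distance r; conversely a shared position is a common cluster, whose
-- weak diameter σ r bounds dist(x, y); and sparseness bounds the label length by τ.

module _ {m : ℕ} where

  memberships : List (Subset m) → Fin m → List ℕ
  memberships []      x = []
  memberships (C ∷ 𝒞) x with lookup C x
  ... | inside  = 0 ∷ map ℕ.suc (memberships 𝒞 x)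
  ... | outside = map ℕ.suc (memberships 𝒞 x)

  length-memberships : ∀ 𝒞 x → length (memberships 𝒞 x) ≡ count 𝒞 x
  length-memberships []      x = refl
  length-memberships (C ∷ 𝒞) x with lookup C x
  ... | inside  = cong ℕ.suc (trans (length-map ℕ.suc (memberships 𝒞 x)) (length-memberships 𝒞 x))
  ... | outside = trans (length-map ℕ.suc (memberships 𝒞 x)) (length-memberships 𝒞 x)

  -- Out of range the junk value is the empty cluster, which contains no vertex.
  clusterAt : List (Subset m) → ℕ → Subset m
  clusterAt []      i         = ⊥
  clusterAt (C ∷ 𝒞) ℕ.zero    = C
  clusterAt (C ∷ 𝒞) (ℕ.suc i) = clusterAt 𝒞 i

  clusterAt-∈ : ∀ 𝒞 i {x} → x ∈ clusterAt 𝒞 i → clusterAt 𝒞 i List.∈ 𝒞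
  clusterAt-∈ []      i         x∈ = ⊥-elim (∉⊥ x∈)
  clusterAt-∈ (C ∷ 𝒞) ℕ.zero    x∈ = here refl
  clusterAt-∈ (C ∷ 𝒞) (ℕ.suc i) x∈ = there (clusterAt-∈ 𝒞 i x∈)

  ∈-memberships⁺ : ∀ 𝒞 {C x} (C∈𝒞 : C List.∈ 𝒞) → x ∈ C →
                   toℕ (index C∈𝒞) List.∈ memberships 𝒞 x
  ∈-memberships⁺ (C ∷ 𝒞) {x = x} (here refl) x∈C rewrite []=⇒lookup x∈C = here refl
  ∈-memberships⁺ (D ∷ 𝒞) {x = x} (there C∈𝒞) x∈C with lookup D x
  ... | inside  = there (∈-map⁺ ℕ.suc (∈-memberships⁺ 𝒞 C∈𝒞 x∈C))
  ... | outside = ∈-map⁺ ℕ.suc (∈-memberships⁺ 𝒞 C∈𝒞 x∈C)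

  ∈-memberships⁻ : ∀ 𝒞 {x i} → i List.∈ memberships 𝒞 x → x ∈ clusterAt 𝒞 i
  ∈-map-suc-memberships⁻ : ∀ C 𝒞 {x i} → i List.∈ map ℕ.suc (memberships 𝒞 x) →
                           x ∈ clusterAt (C ∷ 𝒞) i

  ∈-memberships⁻ (C ∷ 𝒞) {x} i∈ with lookup C x in C[x] | i∈
  ... | inside  | here refl = lookup⇒[]= x C C[x]
  ... | inside  | there i∈′ = ∈-map-suc-memberships⁻ C 𝒞 i∈′
  ... | outside | i∈′       = ∈-map-suc-memberships⁻ C 𝒞 i∈′

  ∈-map-suc-memberships⁻ C 𝒞 i∈ with ∈-map⁻ ℕ.suc i∈
  ... | j , j∈ , refl = ∈-memberships⁻ 𝒞 j∈

  common-cluster⇒sharesEntry : ∀ {𝒞 C x y} → C List.∈ 𝒞 → x ∈ C → y ∈ C →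
                               SharesEntry (memberships 𝒞 x) (memberships 𝒞 y)
  common-cluster⇒sharesEntry {𝒞} C∈𝒞 x∈C y∈C =
    toℕ (index C∈𝒞) , ∈-memberships⁺ 𝒞 C∈𝒞 x∈C , ∈-memberships⁺ 𝒞 C∈𝒞 y∈C

  sharesEntry⇒common-cluster : ∀ {𝒞 x y} → SharesEntry (memberships 𝒞 x) (memberships 𝒞 y) →
                               ∃[ C ] (C List.∈ 𝒞 × x ∈ C × y ∈ C)
  sharesEntry⇒common-cluster {𝒞} (i , i∈x , i∈y) =
    clusterAt 𝒞 i , clusterAt-∈ 𝒞 i x∈ , x∈ , ∈-memberships⁻ 𝒞 i∈y
    where x∈ = ∈-memberships⁻ 𝒞 i∈x

module _ {G : Graph} where

  distLe-refl : ∀ {t} → ℚ.0ℚ ℚ.≤ t → ∀ x → DistLe G x x t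
  distLe-refl 0≤t x = 0 , stay x , 0≤t

  ball-contains : ∀ σ .{{_ : Positive σ}} {r u v C} →
                  BallSubset G σ (σ ℚ.* r) u C → DistLe G u v r → v ∈ C
  ball-contains σ ball (k , walk , k≤r) =
    ball _ (k , walk , ℚ.*-monoˡ-≤-nonNeg σ {{ℚ.pos⇒nonNeg σ}} k≤r)

  IsDisjunctiveADTLabelling : ℚ → ℕ → ℚ → (V G → List ℕ) → Set
  IsDisjunctiveADTLabelling σ L r q =
      (∀ x → length (q x) ℕ.≤ L)
    × (∀ x y → DistLe G x y r → SharesEntry (q x) (q y))
    × (∀ x y → ¬ DistLe G x y (σ ℚ.* r) → ¬ SharesEntry (q x) (q y))

  sparseCover⇒labelling : ∀ σ .{{_ : Positive σ}} τ {r 𝒞} → ℚ.0ℚ ℚ.< r →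
                          SparseCover G σ τ (σ ℚ.* r) 𝒞 →
                          IsDisjunctiveADTLabelling σ τ r (memberships 𝒞)
  sparseCover⇒labelling σ τ {r} {𝒞} r>0 (bounded , covering , sparse) = short , near , far
    where
    short : ∀ x → length (memberships 𝒞 x) ℕ.≤ τ
    short x rewrite length-memberships 𝒞 x = sparse x

    near : ∀ x y → DistLe G x y r → SharesEntry (memberships 𝒞 x) (memberships 𝒞 y)
    near x y x~y with covering x
    ... | C , C∈𝒞 , ball = common-cluster⇒sharesEntry C∈𝒞
      (ball-contains σ ball (distLe-refl (ℚ.<⇒≤ r>0) x)) (ball-contains σ ball x~y)

    far : ∀ x y → ¬ DistLe G x y (σ ℚ.* r) → ¬ SharesEntry (memberships 𝒞 x) (memberships 𝒞 y)
    far x y x≁y shared with sharesEntry⇒common-cluster shared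
    ... | C , C∈𝒞 , x∈C , y∈C = x≁y (bounded C C∈𝒞 x y x∈C y∈C)

theorem5p14 : (𝓕 : GraphClass) (σ : ℚ) (τ : ℕ) → Positive σ →
    ClassHasSparseCoverScheme 𝓕 σ τ → HasDisjunctiveADTScheme 𝓕 σ τ
theorem5p14 𝓕 σ τ σ>0 hasCover r r>0 G G∈𝓕 =
  let 𝒞 , cover = hasCover G G∈𝓕 (σ ℚ.* r) σr>0
  in  memberships 𝒞 , sparseCover⇒labelling σ τ r>0 cover
  where
  instance
    _ = σ>0
    _ = ℚ.positive r>0
  σr>0 : ℚ.0ℚ ℚ.< σ ℚ.* r
  σr>0 = ℚ.positive⁻¹ (σ ℚ.* r) {{ℚ.pos*pos⇒pos σ r}}
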